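{- Let $\lambda=(\lambda_1,\ldots,\lambda_n)$ be a wide partition with $n$ parts, and let $m=\lambda_1$. Let $\mu$ be the partition with $2m+n$ parts $$\mu=(2m+\lambda'_1,\ldots,2m+\lambda'_m,\underbrace{2m,\ldots,2m}_{m\text{ times}},\lambda_1,\ldots,\lambda_n),$$ i.e. the Young diagram of $\mu$ is a $2m\times 2m$ square with the diagram of $\lambda$ attached below it and the diagram of $\lambda'$ attached to its right. Then $\mu$ is a wide partition.
   Context: For partitions $\alpha,\beta$ of the same integer, $\alpha\ge\beta$ (dominance) means $\sum_{k\le j}\alpha_k\ge\sum_{k\le j}\beta_k$ for all $j$; $\mu'$ is the conjugate of $\mu$ (so $\lambda'$ has exactly $\lambda_1=m$ parts). $\nu$ is a subpartition of $\lambda$ if the multiset of parts of $\nu$ is a submultiset of that of $\lambda$. $\lambda$ is wide if $\nu\ge\nu'$ for every subpartition $\nu$ of $\lambda$. -}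

module Defs where

open import Data.Nat using (ℕ; zero; suc; _≤_; _≥_; _≤ᵇ_; _+_)
open import Data.List using (List; []; _∷_; length; filter; map; take; _++_; upTo; replicate; head)
open import Data.List.Relation.Unary.All using (All)
open import Data.List.Relation.Unary.Linked using (Linked)
open import Data.List.Relation.Binary.Permutation.Propositional using (_↭_)
open import Data.Product using (∃)
open import Relation.Nullary.Decidable using (does)
open import Data.Nat using (_≤?_)
open import Data.Nat.ListAction using (sum)

IsPartition : List ℕ → Set
IsPartition l = All (λ x → 1 ≤ x) l × Linked _≥_ l
  where open import Data.Product using (_×_)

largest : List ℕ → ℕ
largest [] = 0
largest (x ∷ _) = x

-- conjugate: μ'_j = #{ i : μ_i ≥ j } for j = 1 .. μ_1
conj : List ℕ → List ℕ
conj μ = map (λ j → length (filter (λ x → suc j ≤? x) μ)) (upTo (largest μ))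

-- dominance α ≥ β : every partial sum of α is ≥ the corresponding one of β
-- (parts beyond the length are 0; take returns the whole list then)
Dominates : List ℕ → List ℕ → Set
Dominates α β = (j : ℕ) → sum (take j β) ≤ sum (take j α)

-- ν is a subpartition of λ : ν is a partition whose multiset of parts is
-- a submultiset of that of λ
Subpartition : List ℕ → List ℕ → Set
Subpartition ν l = IsPartition ν × ∃ (λ ρ → (ν ++ ρ) ↭ l)
  where open import Data.Product using (_×_)

Wide : List ℕ → Set
Wide l = (ν : List ℕ) → Subpartition ν l → Dominates ν (conj ν)

bigμ : List ℕ → List ℕ
bigμ l = map (λ x → 2 * m + x) (conj l) ++ replicate m (2 * m) ++ l
  where
    open import Data.Nat using (_*_)
    m = largest l

{-# OPTIONS --safe #-}
module Submission where

open import Defs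
open import Data.Nat using (ℕ)
open import Data.List using (List)

open import Data.Empty using (⊥-elim)
open import Data.List using ([]; _∷_; [_]; _++_; map; take; drop; filter; length; applyUpTo; replicate)
open import Data.List.Properties
  using ( map-++; map-∘; map-cong; map-cong-local; map-id; map-id-local; map-applyUpTo
        ; length-++; length-map; length-replicate; length-filter; length-applyUpTo
        ; filter-++; filter-accept; filter-reject; filter-all; filter-none; partition-defn
        ; take++drop≡id; take-all; drop-drop; ++-assoc; ++-identityʳ )
open import Data.List.Relation.Unary.All as All using (All; []; _∷_)
import Data.List.Relation.Unary.All.Properties as All
open import Data.List.Relation.Unary.Linked as Linked using (Linked; [])
import Data.List.Relation.Unary.Linked.Properties as Linked
open import Data.List.Relation.Binary.Permutation.Propositional
  using (_↭_; ↭-sym; ↭-trans; ↭-reflexive; ↭ₛ⇒↭)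
import Data.List.Relation.Binary.Permutation.Propositional.Properties as ↭
import Data.List.Relation.Binary.Permutation.Setoid.Properties as ↭ₛ
import Data.List.Relation.Binary.Sublist.Propositional as Sublist
import Data.List.Relation.Binary.Sublist.Propositional.Properties as Sublist
open import Data.Nat
  using (zero; suc; _+_; _*_; _∸_; _⊓_; _≤_; _<_; _≥_; z≤n; s≤s; s≤s⁻¹; _≤?_; _<?_; _≟_)
open import Data.Nat.ListAction using (sum)
open import Data.Nat.ListAction.Properties using (sum-++; sum-↭)
open import Data.Nat.Properties
open import Algebra.Properties.CommutativeSemigroup +-commutativeSemigroup
  using () renaming (interchange to +-interchange; xy∙z≈xz∙y to +-right-comm)
open import Data.Nat.Tactic.RingSolver using (solve-∀)
open import Data.Product using (∃; _,_; proj₁; proj₂)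
open import Function using (_∘_; _⇔_; mk⇔; Equivalence)
open import Relation.Binary.Definitions using (tri<; tri≈; tri>)
open import Relation.Binary.PropositionalEquality
  using (_≡_; refl; sym; trans; cong; cong₂; subst; setoid; module ≡-Reasoning)
open import Relation.Nullary using (¬_; yes; no)
open import Relation.Unary using (Decidable)
open import Relation.Unary.Properties using (∁?)

-- Write σₜ(ν) = Σᵢ min(νᵢ, t), the sum of the first t parts of ν′, so that ν ≥ ν′ says
-- σₜ(ν) ≤ ν₁ + ⋯ + νₜ for all t.  A subpartition ν of μ splits at the value 2m into parts
-- 2m + αᵢ with α ⊆ λ′, b ≤ m parts equal to 2m, and a subpartition K of λ.  Put a = ℓ(α) and
-- r = m − a.  Comparing the a-element submultiset α of λ′ with λ′ gives λ′ᵣ₊ᵢ ≤ αᵢ, and all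
-- three ranges of t reduce to wideness of λ and of its subpartitions:
--   t ≤ a + b:      σₜ(K) ≤ σₜ(λ) ≤ rt + (λ′ᵣ₊₁ + ⋯ + λ′ᵣ₊ₜ) ≤ rt + (α₁ + ⋯ + αₜ), applying
--                   wideness to the parts of λ below r + t;
--   a + b < t ≤ 2m: with s = t − a − b, wideness of K bounds σₛ(K) by K₁ + ⋯ + Kₛ, and the rest
--                   Σᵢ (min(Kᵢ, t) − s)⁺ is at most (a + b)(2m − t) + Σα because ℓ(λ) ≤ m;
--   t > 2m:         with s = t − 2m, the parts of K after the first t − a − b sum to at most the
--                   parts of λ after the first s + r; wideness of λₛ₊₁ ≥ λₛ₊₂ ≥ ⋯ bounds these by
--                   Σ_{i>s} (λᵢ − r)⁺ = Σⱼ (λ′ᵣ₊ⱼ − s)⁺ ≤ Σⱼ (αⱼ − s)⁺.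

⊓+∸ : ∀ x r → x ⊓ r + (x ∸ r) ≡ x
⊓+∸ x r = trans (cong (_+ (x ∸ r)) (⊓-comm x r)) (m⊓n+n∸m≡n r x)

⊓-split : ∀ {s t} → s ≤ t → ∀ x → x ⊓ t ≡ x ⊓ s + (x ⊓ t ∸ s)
⊓-split {s} {t} s≤t x = begin
  x ⊓ t                        ≡⟨ sym (⊓+∸ (x ⊓ t) s) ⟩
  (x ⊓ t) ⊓ s + (x ⊓ t ∸ s)    ≡⟨ cong (_+ (x ⊓ t ∸ s)) (⊓-assoc x t s) ⟩
  x ⊓ (t ⊓ s) + (x ⊓ t ∸ s)    ≡⟨ cong (λ u → x ⊓ u + (x ⊓ t ∸ s)) (m≥n⇒m⊓n≡n s≤t) ⟩
  x ⊓ s + (x ⊓ t ∸ s)          ∎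
  where open ≡-Reasoning

∸-triangle : ∀ x r s → x ∸ s ≤ (x ∸ r) + (r ∸ s)
∸-triangle x r s = m≤n+o⇒m∸n≤o x s (begin
  x                        ≤⟨ m≤n+m∸n x r ⟩
  r + (x ∸ r)              ≤⟨ +-monoˡ-≤ (x ∸ r) (m≤n+m∸n r s) ⟩
  (s + (r ∸ s)) + (x ∸ r)  ≡⟨ +-assoc s (r ∸ s) (x ∸ r) ⟩
  s + ((r ∸ s) + (x ∸ r))  ≡⟨ cong (s +_) (+-comm (r ∸ s) (x ∸ r)) ⟩
  s + ((x ∸ r) + (r ∸ s))  ∎)
  where open ≤-Reasoning

*-∸-exchange : ∀ m b x → b ≤ m → m * (b ∸ x) ≤ b * (m ∸ x)
*-∸-exchange m b x b≤m = begin
  m * (b ∸ x)    ≡⟨ *-distribˡ-∸ m b x ⟩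
  m * b ∸ m * x  ≤⟨ ∸-monoʳ-≤ (m * b) (*-monoˡ-≤ x b≤m) ⟩
  m * b ∸ b * x  ≡⟨ cong (_∸ b * x) (*-comm m b) ⟩
  b * m ∸ b * x  ≡⟨ sym (*-distribˡ-∸ b m x) ⟩
  b * (m ∸ x)    ∎
  where open ≤-Reasoning

sumMap : (ℕ → ℕ) → List ℕ → ℕ
sumMap f xs = sum (map f xs)

syntax sumMap (λ x → e) xs = ∑[ x ← xs ] e

sumUpTo : (ℕ → ℕ) → ℕ → ℕ
sumUpTo f k = sum (applyUpTo f k)

syntax sumUpTo (λ j → e) k = ∑[ j < k ] e

sumMap-++ : ∀ f xs ys → sumMap f (xs ++ ys) ≡ sumMap f xs + sumMap f ys
sumMap-++ f xs ys = trans (cong sum (map-++ f xs ys)) (sum-++ (map f xs) (map f ys))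

sumMap-↭ : ∀ f {xs ys} → xs ↭ ys → sumMap f xs ≡ sumMap f ys
sumMap-↭ f p = sum-↭ (↭.map⁺ f p)

sumMap-cong : ∀ {f g} → (∀ x → f x ≡ g x) → ∀ xs → sumMap f xs ≡ sumMap g xs
sumMap-cong f≗g xs = cong sum (map-cong f≗g xs)

sumMap-cong-local : ∀ {f g xs} → All (λ x → f x ≡ g x) xs → sumMap f xs ≡ sumMap g xs
sumMap-cong-local eqs = cong sum (map-cong-local eqs)

sumMap-mono : ∀ {f g} → (∀ x → f x ≤ g x) → ∀ xs → sumMap f xs ≤ sumMap g xs
sumMap-mono f≤g []       = z≤n
sumMap-mono f≤g (x ∷ xs) = +-mono-≤ (f≤g x) (sumMap-mono f≤g xs)

sumMap-+ : ∀ f g xs → ∑[ x ← xs ] (f x + g x) ≡ sumMap f xs + sumMap g xs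
sumMap-+ f g []       = refl
sumMap-+ f g (x ∷ xs) = begin
  (f x + g x) + ∑[ y ← xs ] (f y + g y)      ≡⟨ cong ((f x + g x) +_) (sumMap-+ f g xs) ⟩
  (f x + g x) + (sumMap f xs + sumMap g xs)  ≡⟨ +-interchange (f x) (g x) _ _ ⟩
  (f x + sumMap f xs) + (g x + sumMap g xs)  ∎
  where open ≡-Reasoning

sumMap-const : ∀ c xs → ∑[ x ← xs ] c ≡ length xs * c
sumMap-const c []       = refl
sumMap-const c (x ∷ xs) = cong (c +_) (sumMap-const c xs)

sumMap-replicate : ∀ f b c → sumMap f (replicate b c) ≡ b * f c
sumMap-replicate f zero    c = refl
sumMap-replicate f (suc b) c = cong (f c +_) (sumMap-replicate f b c)

sumMap-map : ∀ f g xs → sumMap f (map g xs) ≡ sumMap (f ∘ g) xs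
sumMap-map f g xs = cong sum (sym (map-∘ xs))

sumMap-id : ∀ xs → ∑[ x ← xs ] x ≡ sum xs
sumMap-id xs = cong sum (map-id xs)

sumMap-⊓-∸ : ∀ r xs → ∑[ x ← xs ] (x ⊓ r) + ∑[ x ← xs ] (x ∸ r) ≡ sum xs
sumMap-⊓-∸ r xs = begin
  ∑[ x ← xs ] (x ⊓ r) + ∑[ x ← xs ] (x ∸ r)  ≡⟨ sym (sumMap-+ (_⊓ r) (_∸ r) xs) ⟩
  ∑[ x ← xs ] (x ⊓ r + (x ∸ r))              ≡⟨ sumMap-cong (λ x → ⊓+∸ x r) xs ⟩
  ∑[ x ← xs ] x                              ≡⟨ sumMap-id xs ⟩
  sum xs                                     ∎
  where open ≡-Reasoning

sumUpTo-cong : ∀ {f g} → (∀ j → f j ≡ g j) → ∀ k → sumUpTo f k ≡ sumUpTo g k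
sumUpTo-cong f≗g zero    = refl
sumUpTo-cong f≗g (suc k) = cong₂ _+_ (f≗g 0) (sumUpTo-cong (f≗g ∘ suc) k)

sumUpTo-mono : ∀ {f g} → (∀ j → f j ≤ g j) → ∀ k → sumUpTo f k ≤ sumUpTo g k
sumUpTo-mono f≤g zero    = z≤n
sumUpTo-mono f≤g (suc k) = +-mono-≤ (f≤g 0) (sumUpTo-mono (f≤g ∘ suc) k)

sumUpTo-zero : ∀ k → ∑[ j < k ] 0 ≡ 0
sumUpTo-zero zero    = refl
sumUpTo-zero (suc k) = sumUpTo-zero k

sumUpTo-+ : ∀ f g k → ∑[ j < k ] (f j + g j) ≡ sumUpTo f k + sumUpTo g k
sumUpTo-+ f g zero    = refl
sumUpTo-+ f g (suc k) = begin
  (f 0 + g 0) + ∑[ j < k ] (f (suc j) + g (suc j))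
    ≡⟨ cong ((f 0 + g 0) +_) (sumUpTo-+ (f ∘ suc) (g ∘ suc) k) ⟩
  (f 0 + g 0) + (sumUpTo (f ∘ suc) k + sumUpTo (g ∘ suc) k)
    ≡⟨ +-interchange (f 0) (g 0) _ _ ⟩
  (f 0 + sumUpTo (f ∘ suc) k) + (g 0 + sumUpTo (g ∘ suc) k)
    ∎
  where open ≡-Reasoning

sum-take-drop : ∀ k xs → sum (take k xs) + sum (drop k xs) ≡ sum xs
sum-take-drop k xs = trans (sym (sum-++ (take k xs) (drop k xs))) (cong sum (take++drop≡id k xs))

sum-take-1 : ∀ xs → sum (take 1 xs) ≡ largest xs
sum-take-1 []       = refl
sum-take-1 (x ∷ xs) = +-identityʳ x

sum-take-++ : ∀ xs ys {t} → length xs ≤ t → sum (take t (xs ++ ys)) ≡ sum xs + sum (take (t ∸ length xs) ys)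
sum-take-++ []       ys         _            = refl
sum-take-++ (x ∷ xs) ys {suc t} (s≤s |xs|≤t) =
  trans (cong (x +_) (sum-take-++ xs ys |xs|≤t)) (sym (+-assoc x (sum xs) _))

sum-take-replicate : ∀ c b K {t} → t ≤ b → sum (take t (replicate b c ++ K)) ≡ c * t
sum-take-replicate c b       K {zero}  _         = sym (*-zeroʳ c)
sum-take-replicate c (suc b) K {suc t} (s≤s t≤b) =
  trans (cong (c +_) (sum-take-replicate c b K t≤b)) (sym (*-suc c t))

sum-take-blocks : ∀ c α b K {t} → t ≤ length α + b →
                  sum (take t (map (c +_) α ++ replicate b c ++ K)) ≡ c * t + sum (take t α)
sum-take-blocks c α       b K {zero}  _   = sym (trans (+-identityʳ (c * 0)) (*-zeroʳ c))
sum-take-blocks c []      b K {suc t} t≤b = trans (sum-take-replicate c b K t≤b) (sym (+-identityʳ (c * suc t)))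
sum-take-blocks c (y ∷ α) b K {suc t} (s≤s t≤a+b) = begin
  (c + y) + sum (take t (map (c +_) α ++ replicate b c ++ K))  ≡⟨ cong ((c + y) +_) (sum-take-blocks c α b K t≤a+b) ⟩
  (c + y) + (c * t + sum (take t α))                           ≡⟨ +-interchange c y (c * t) _ ⟩
  (c + c * t) + (y + sum (take t α))                           ≡⟨ cong (_+ (y + sum (take t α))) (sym (*-suc c t)) ⟩
  c * suc t + (y + sum (take t α))                             ∎
  where open ≡-Reasoning

sum-take≤ : ∀ r t xs → sum (take t xs) ≤ t * r + ∑[ x ← xs ] (x ∸ r)
sum-take≤ r zero    xs       = z≤n
sum-take≤ r (suc t) []       = z≤n
sum-take≤ r (suc t) (x ∷ xs) =
  ≤-trans (+-mono-≤ (m≤n+m∸n x r) (sum-take≤ r t xs)) (≤-reflexive (+-interchange r (x ∸ r) (t * r) _))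

sum-drop-antitone : ∀ {k k'} xs → k ≤ k' → sum (drop k' xs) ≤ sum (drop k xs)
sum-drop-antitone {zero}  {k'}     xs       _          = ≤-trans (m≤n+m _ _) (≤-reflexive (sum-take-drop k' xs))
sum-drop-antitone {suc k} {suc k'} []       _          = z≤n
sum-drop-antitone {suc k} {suc k'} (x ∷ xs) (s≤s k≤k') = sum-drop-antitone xs k≤k'

sum-drop≤sumMap-∸ : ∀ r δ → ∑[ x ← δ ] (x ⊓ r) ≤ sum (take r δ) → sum (drop r δ) ≤ ∑[ x ← δ ] (x ∸ r)
sum-drop≤sumMap-∸ r δ dom = +-cancelˡ-≤ (∑[ x ← δ ] (x ⊓ r)) _ _ (begin
  ∑[ x ← δ ] (x ⊓ r) + sum (drop r δ)        ≤⟨ +-monoˡ-≤ _ dom ⟩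
  sum (take r δ) + sum (drop r δ)            ≡⟨ sum-take-drop r δ ⟩
  sum δ                                      ≡⟨ sym (sumMap-⊓-∸ r δ) ⟩
  ∑[ x ← δ ] (x ⊓ r) + ∑[ x ← δ ] (x ∸ r)    ∎)
  where open ≤-Reasoning

infix 4 _⊆ₘ_

_⊆ₘ_ : {A : Set} → List A → List A → Set
xs ⊆ₘ ys = ∃ λ zs → xs ++ zs ↭ ys

module _ {A : Set} where

  ⊆ₘ-refl : (xs : List A) → xs ⊆ₘ xs
  ⊆ₘ-refl xs = [] , ↭-reflexive (++-identityʳ xs)

  drop-⊆ₘ : ∀ k (xs : List A) → drop k xs ⊆ₘ xs
  drop-⊆ₘ k xs = take k xs , ↭-trans (↭.++-comm (drop k xs) (take k xs)) (↭-reflexive (take++drop≡id k xs))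

  filter-⊆ₘ : ∀ {P : A → Set} (P? : Decidable P) xs → filter P? xs ⊆ₘ xs
  filter-⊆ₘ P? xs = filter (∁? P?) xs , ↭-sym (subst (λ p → xs ↭ proj₁ p ++ proj₂ p) (partition-defn P? xs)
                                                      (↭ₛ⇒↭ (↭ₛ.partition-↭ (setoid A) P? xs)))

  filter⁺-⊆ₘ : ∀ {P : A → Set} (P? : Decidable P) {xs ys} → xs ⊆ₘ ys → filter P? xs ⊆ₘ filter P? ys
  filter⁺-⊆ₘ P? {xs} (zs , p) = filter P? zs , subst (_↭ _) (filter-++ P? xs zs) (↭.filter-↭ P? p)

  map⁺-⊆ₘ : ∀ {B : Set} (f : A → B) {xs ys} → xs ⊆ₘ ys → map f xs ⊆ₘ map f ys
  map⁺-⊆ₘ f {xs} (zs , p) = map f zs , subst (_↭ _) (map-++ f xs zs) (↭.map⁺ f p)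

  All-resp-⊆ₘ : ∀ {P : A → Set} {xs ys} → xs ⊆ₘ ys → All P ys → All P xs
  All-resp-⊆ₘ {xs = xs} (zs , p) pys = All.++⁻ˡ xs (↭.All-resp-↭ (↭-sym p) pys)

  additive-mono-⊆ₘ : (f : List A → ℕ) → (∀ xs ys → f (xs ++ ys) ≡ f xs + f ys) →
                     (∀ {xs ys} → xs ↭ ys → f xs ≡ f ys) → ∀ {xs ys} → xs ⊆ₘ ys → f xs ≤ f ys
  additive-mono-⊆ₘ f f-++ f-↭ {xs} (zs , p) =
    ≤-trans (m≤m+n (f xs) (f zs)) (≤-reflexive (trans (sym (f-++ xs zs)) (f-↭ p)))

  length-mono-⊆ₘ : ∀ {xs ys : List A} → xs ⊆ₘ ys → length xs ≤ length ys
  length-mono-⊆ₘ = additive-mono-⊆ₘ length (λ xs _ → length-++ xs) ↭.↭-length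

sumMap-mono-⊆ₘ : ∀ f {xs ys} → xs ⊆ₘ ys → sumMap f xs ≤ sumMap f ys
sumMap-mono-⊆ₘ f = additive-mono-⊆ₘ (sumMap f) (sumMap-++ f) (sumMap-↭ f)

sumMap-partition : ∀ {P : ℕ → Set} (P? : Decidable P) f xs →
                   sumMap f (filter P? xs) + sumMap f (filter (∁? P?) xs) ≡ sumMap f xs
sumMap-partition P? f xs =
  trans (sym (sumMap-++ f (filter P? xs) (filter (∁? P?) xs))) (sumMap-↭ f (proj₂ (filter-⊆ₘ P? xs)))

Sorted : List ℕ → Set
Sorted = Linked _≥_

≥-trans : ∀ {a b c : ℕ} → a ≥ b → b ≥ c → a ≥ c
≥-trans a≥b b≥c = ≤-trans b≥c a≥b

Sorted⇒All≤head : ∀ {x xs} → Sorted (x ∷ xs) → All (_≤ x) xs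
Sorted⇒All≤head s = All.tail (Linked.Linked⇒All ≥-trans ≤-refl s)

Sorted-All≤ : ∀ {j x xs} → Sorted (x ∷ xs) → x ≤ j → All (_≤ j) (x ∷ xs)
Sorted-All≤ s x≤j = x≤j ∷ All.map (λ y≤x → ≤-trans y≤x x≤j) (Sorted⇒All≤head s)

Sorted⇒All≤largest : ∀ {xs} → Sorted xs → All (_≤ largest xs) xs
Sorted⇒All≤largest {[]}    s = []
Sorted⇒All≤largest {_ ∷ _} s = Sorted-All≤ s ≤-refl

Sorted-drop : ∀ k {xs} → Sorted xs → Sorted (drop k xs)
Sorted-drop zero    s = s
Sorted-drop (suc k) {[]}    s = []
Sorted-drop (suc k) {_ ∷ _} s = Sorted-drop k (Linked.tail s)

IsPartition-filter : ∀ {P : ℕ → Set} (P? : Decidable P) {xs} → IsPartition xs → IsPartition (filter P? xs)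
IsPartition-filter P? (pos , s) = All.filter⁺ P? pos , Linked.filter⁺ P? {R = _≥_} ≥-trans s

IsPartition-drop : ∀ k {xs} → IsPartition xs → IsPartition (drop k xs)
IsPartition-drop k (pos , s) = All.drop⁺ k pos , Sorted-drop k s

countAbove : ℕ → List ℕ → ℕ
countAbove j xs = length (filter (j <?_) xs)

countAbove-accept : ∀ {j x} xs → j < x → countAbove j (x ∷ xs) ≡ suc (countAbove j xs)
countAbove-accept {j} xs j<x = cong length (filter-accept (j <?_) j<x)

countAbove-reject : ∀ {j x} xs → ¬ j < x → countAbove j (x ∷ xs) ≡ countAbove j xs
countAbove-reject {j} xs j≮x = cong length (filter-reject (j <?_) j≮x)

countAbove-++ : ∀ j xs ys → countAbove j (xs ++ ys) ≡ countAbove j xs + countAbove j ys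
countAbove-++ j xs ys = trans (cong length (filter-++ (j <?_) xs ys)) (length-++ (filter (j <?_) xs))

countAbove-↭ : ∀ j {xs ys} → xs ↭ ys → countAbove j xs ≡ countAbove j ys
countAbove-↭ j p = ↭.↭-length (↭.filter-↭ (j <?_) p)

countAbove-mono-⊆ₘ : ∀ j {xs ys} → xs ⊆ₘ ys → countAbove j xs ≤ countAbove j ys
countAbove-mono-⊆ₘ j = additive-mono-⊆ₘ (countAbove j) (countAbove-++ j) (countAbove-↭ j)

countAbove≤length : ∀ j xs → countAbove j xs ≤ length xs
countAbove≤length j = length-filter (j <?_)

countAbove-all≤ : ∀ {j xs} → All (_≤ j) xs → countAbove j xs ≡ 0
countAbove-all≤ {j} xs≤j = cong length (filter-none (j <?_) (All.map (λ x≤j j<x → <⇒≱ j<x x≤j) xs≤j))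

countAbove-suc≤ : ∀ j xs → countAbove (suc j) xs ≤ countAbove j xs
countAbove-suc≤ j xs =
  Sublist.length-mono-≤ (Sublist.filter⁺ (suc j <?_) (j <?_) (λ { refl → <⇒≤ }) (Sublist.⊆-refl {x = xs}))

countAbove-suc-suc : ∀ j x → countAbove (suc j) [ suc x ] ≡ countAbove j [ x ]
countAbove-suc-suc j x with j <? x
... | yes j<x = trans (countAbove-accept [] (s≤s j<x)) (sym (countAbove-accept [] j<x))
... | no j≮x  = trans (countAbove-reject [] (j≮x ∘ s≤s⁻¹)) (sym (countAbove-reject [] j≮x))

countAbove-zero : ∀ j → countAbove j [ 0 ] ≡ 0
countAbove-zero j = countAbove-reject {j} {0} [] λ ()

countAbove-shift : ∀ u j x → countAbove (u + j) [ x ] ≡ countAbove j [ x ∸ u ]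
countAbove-shift zero    j x       = refl
countAbove-shift (suc u) j zero    = trans (countAbove-zero (suc u + j)) (sym (countAbove-zero j))
countAbove-shift (suc u) j (suc x) = trans (countAbove-suc-suc (u + j) x) (countAbove-shift u j x)

sumUpTo-countAbove-singleton : ∀ y k → ∑[ j < k ] countAbove j [ y ] ≡ y ⊓ k
sumUpTo-countAbove-singleton zero    zero    = refl
sumUpTo-countAbove-singleton (suc y) zero    = refl
sumUpTo-countAbove-singleton zero    (suc k) = trans (sumUpTo-cong countAbove-zero (suc k)) (sumUpTo-zero (suc k))
sumUpTo-countAbove-singleton (suc y) (suc k) = cong₂ _+_ (countAbove-accept {0} {suc y} [] (s≤s z≤n))
  (trans (sumUpTo-cong (λ j → countAbove-suc-suc j y) k) (sumUpTo-countAbove-singleton y k))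

-- Both sides count the cells of the diagram of xs lying in columns u + 1, …, u + k.
sumUpTo-countAbove : ∀ u k xs → ∑[ j < k ] countAbove (u + j) xs ≡ ∑[ x ← xs ] ((x ∸ u) ⊓ k)
sumUpTo-countAbove u k []       = sumUpTo-zero k
sumUpTo-countAbove u k (x ∷ xs) = begin
  ∑[ j < k ] countAbove (u + j) (x ∷ xs)
    ≡⟨ sumUpTo-cong (λ j → countAbove-++ (u + j) [ x ] xs) k ⟩
  ∑[ j < k ] (countAbove (u + j) [ x ] + countAbove (u + j) xs)
    ≡⟨ sumUpTo-+ _ _ k ⟩
  ∑[ j < k ] countAbove (u + j) [ x ] + ∑[ j < k ] countAbove (u + j) xs
    ≡⟨ cong₂ _+_ singleton (sumUpTo-countAbove u k xs) ⟩
  (x ∸ u) ⊓ k + ∑[ y ← xs ] ((y ∸ u) ⊓ k)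
    ∎
  where
    open ≡-Reasoning
    singleton = trans (sumUpTo-cong (λ j → countAbove-shift u j x) k) (sumUpTo-countAbove-singleton (x ∸ u) k)

countAbove-drop : ∀ j k {xs} → Sorted xs → countAbove j (drop k xs) ≡ countAbove j xs ∸ k
countAbove-drop j zero    s = refl
countAbove-drop j (suc k) {[]}     s = refl
countAbove-drop j (suc k) {x ∷ xs} s with j <? x
... | yes j<x = trans (countAbove-drop j k (Linked.tail s)) (cong (_∸ suc k) (sym (countAbove-accept xs j<x)))
... | no j≮x  = begin
  countAbove j (drop k xs)       ≡⟨ countAbove-all≤ (All.drop⁺ k (All.tail x∷xs≤j)) ⟩
  0                              ≡⟨ sym (0∸n≡0 (suc k)) ⟩
  0 ∸ suc k                      ≡⟨ cong (_∸ suc k) (sym (countAbove-all≤ x∷xs≤j)) ⟩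
  countAbove j (x ∷ xs) ∸ suc k  ∎
  where
    open ≡-Reasoning
    x∷xs≤j = Sorted-All≤ s (≮⇒≥ j≮x)

sum-drop≡sumUpTo : ∀ h k {xs} → Sorted xs → All (_≤ h) xs → sum (drop k xs) ≡ ∑[ j < h ] (countAbove j xs ∸ k)
sum-drop≡sumUpTo h k {xs} s xs≤h = begin
  sum (drop k xs)                      ≡⟨ sym (sumMap-id (drop k xs)) ⟩
  ∑[ x ← drop k xs ] x                 ≡⟨ sumMap-cong-local (All.map (sym ∘ m≤n⇒m⊓n≡m) (All.drop⁺ k xs≤h)) ⟩
  ∑[ x ← drop k xs ] (x ⊓ h)           ≡⟨ sym (sumUpTo-countAbove 0 h (drop k xs)) ⟩
  ∑[ j < h ] countAbove j (drop k xs)  ≡⟨ sumUpTo-cong (λ j → countAbove-drop j k s) h ⟩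
  ∑[ j < h ] (countAbove j xs ∸ k)     ∎
  where open ≡-Reasoning

sum-drop-mono-⊆ₘ : ∀ {xs ys} → Sorted xs → Sorted ys → xs ⊆ₘ ys → ∀ k → sum (drop k xs) ≤ sum (drop k ys)
sum-drop-mono-⊆ₘ {xs} {ys} sxs sys xs⊆ys k = begin
  sum (drop k xs)                   ≡⟨ sum-drop≡sumUpTo h k sxs (All-resp-⊆ₘ xs⊆ys ys≤h) ⟩
  ∑[ j < h ] (countAbove j xs ∸ k)  ≤⟨ sumUpTo-mono (λ j → ∸-monoˡ-≤ k (countAbove-mono-⊆ₘ j xs⊆ys)) h ⟩
  ∑[ j < h ] (countAbove j ys ∸ k)  ≡⟨ sym (sum-drop≡sumUpTo h k sys ys≤h) ⟩
  sum (drop k ys)                   ∎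
  where
    open ≤-Reasoning
    h = largest ys
    ys≤h = Sorted⇒All≤largest sys

-- Indexed from 0, and 0 past the end of xs.
part : List ℕ → ℕ → ℕ
part []       i       = 0
part (x ∷ xs) zero    = x
part (x ∷ xs) (suc i) = part xs i

part-bounded : ∀ {c xs} → All (_≤ c) xs → ∀ i → part xs i ≤ c
part-bounded []         i       = z≤n
part-bounded (x≤c ∷ _)  zero    = x≤c
part-bounded (_ ∷ xs≤c) (suc i) = part-bounded xs≤c i

part-applyUpTo : ∀ g h → (∀ j → h ≤ j → g j ≡ 0) → ∀ j → part (applyUpTo g h) j ≡ g j
part-applyUpTo g zero    g≡0 j       = sym (g≡0 j z≤n)
part-applyUpTo g (suc h) g≡0 zero    = refl
part-applyUpTo g (suc h) g≡0 (suc j) = part-applyUpTo (g ∘ suc) h (λ j h≤j → g≡0 (suc j) (s≤s h≤j)) j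

sumUpTo-part : ∀ f → f 0 ≡ 0 → ∀ xs k → ∑[ i < k ] f (part xs i) ≡ sumMap f (take k xs)
sumUpTo-part f f0≡0 xs       zero    = refl
sumUpTo-part f f0≡0 []       (suc k) = trans (sumUpTo-cong (λ _ → f0≡0) (suc k)) (sumUpTo-zero (suc k))
sumUpTo-part f f0≡0 (x ∷ xs) (suc k) = cong (f x +_) (sumUpTo-part f f0≡0 xs k)

countAbove-part : ∀ {xs} → Sorted xs → ∀ j k → k < countAbove j xs ⇔ j < part xs k
countAbove-part {[]} s j k = mk⇔ (λ ()) (λ ())
countAbove-part {x ∷ xs} s j k with j <? x
countAbove-part {x ∷ xs} s j zero    | yes j<x rewrite countAbove-accept xs j<x =
  mk⇔ (λ _ → j<x) (λ _ → s≤s z≤n)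
countAbove-part {x ∷ xs} s j (suc k) | yes j<x rewrite countAbove-accept xs j<x =
  mk⇔ (Equivalence.to ih ∘ s≤s⁻¹) (s≤s ∘ Equivalence.from ih)
  where ih = countAbove-part (Linked.tail s) j k
countAbove-part {x ∷ xs} s j k       | no j≮x =
  mk⇔ (λ k<count → ⊥-elim (n≮0 (subst (k <_) (countAbove-all≤ x∷xs≤j) k<count)))
      (λ j<part → ⊥-elim (<⇒≱ j<part (part-bounded x∷xs≤j k)))
  where x∷xs≤j = Sorted-All≤ s (≮⇒≥ j≮x)

-- If v = ys_i were below xs_{r+i}, more than r + i parts of xs would exceed v, whereas at most
-- i parts of ys and the r remaining parts of xs do.
part-⊆ₘ : ∀ {xs ys} → Sorted xs → Sorted ys → ys ⊆ₘ xs → ∀ i → part xs (length xs ∸ length ys + i) ≤ part ys i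
part-⊆ₘ {xs} {ys} sxs sys (zs , p) i = ≮⇒≥ λ v<part →
  <⇒≱ (Equivalence.from (countAbove-part sxs v (r + i)) v<part) (≤-trans count≤ (≤-reflexive (+-comm i r)))
  where
    open ≤-Reasoning
    v = part ys i
    r = length xs ∸ length ys
    length-zs : length zs ≡ r
    length-zs = trans (sym (m+n∸m≡n (length ys) (length zs)))
                      (cong (_∸ length ys) (trans (sym (length-++ ys)) (↭.↭-length p)))
    count-ys≤ : countAbove v ys ≤ i
    count-ys≤ = ≮⇒≥ λ i<count → <-irrefl refl (Equivalence.to (countAbove-part sys v i) i<count)
    count≤ : countAbove v xs ≤ i + r
    count≤ = begin
      countAbove v xs                    ≡⟨ sym (countAbove-↭ v p) ⟩
      countAbove v (ys ++ zs)            ≡⟨ countAbove-++ v ys zs ⟩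
      countAbove v ys + countAbove v zs  ≤⟨ +-mono-≤ count-ys≤ (≤-trans (countAbove≤length v zs) (≤-reflexive length-zs)) ⟩
      i + r                              ∎

-- The conjugate partition

conj≡applyUpTo : ∀ ν → conj ν ≡ applyUpTo (λ j → countAbove j ν) (largest ν)
conj≡applyUpTo ν = map-applyUpTo (λ j → j) (λ j → countAbove j ν) (largest ν)

length-conj : ∀ ν → length (conj ν) ≡ largest ν
length-conj ν = trans (cong length (conj≡applyUpTo ν)) (length-applyUpTo _ (largest ν))

Sorted-conj : ∀ ν → Sorted (conj ν)
Sorted-conj ν = subst Sorted (sym (conj≡applyUpTo ν)) (Linked.applyUpTo⁺₂ _ (largest ν) (λ j → countAbove-suc≤ j ν))

conj-positive : ∀ ν → All (1 ≤_) (conj ν)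
conj-positive ν = subst (All (1 ≤_)) (sym (conj≡applyUpTo ν)) (All.applyUpTo⁺₁ _ (largest ν) (positive ν))
  where
    positive : ∀ ν {j} → j < largest ν → 1 ≤ countAbove j ν
    positive (x ∷ xs) j<x = subst (1 ≤_) (sym (countAbove-accept xs j<x)) (s≤s z≤n)

part-conj : ∀ {ν} → Sorted ν → ∀ j → part (conj ν) j ≡ countAbove j ν
part-conj {ν} s j = trans (cong (λ xs → part xs j) (conj≡applyUpTo ν)) (part-applyUpTo _ (largest ν) vanish j)
  where
    vanish : ∀ j → largest ν ≤ j → countAbove j ν ≡ 0
    vanish j h≤j = countAbove-all≤ (All.map (λ x≤h → ≤-trans x≤h h≤j) (Sorted⇒All≤largest s))

sum-take-conj : ∀ {ν} → Sorted ν → ∀ t → sum (take t (conj ν)) ≡ ∑[ x ← ν ] (x ⊓ t)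
sum-take-conj {ν} s t = begin
  sum (take t (conj ν))       ≡⟨ sym (sumMap-id (take t (conj ν))) ⟩
  ∑[ x ← take t (conj ν) ] x  ≡⟨ sym (sumUpTo-part (λ x → x) refl (conj ν) t) ⟩
  ∑[ i < t ] part (conj ν) i  ≡⟨ sumUpTo-cong (part-conj s) t ⟩
  ∑[ i < t ] countAbove i ν   ≡⟨ sumUpTo-countAbove 0 t ν ⟩
  ∑[ x ← ν ] (x ⊓ t)          ∎
  where open ≡-Reasoning

Dominates-conj⇔ : ∀ {ν} → Sorted ν → Dominates ν (conj ν) ⇔ (∀ t → ∑[ x ← ν ] (x ⊓ t) ≤ sum (take t ν))
Dominates-conj⇔ {ν} s = mk⇔ (λ dom t → subst (_≤ sum (take t ν)) (sum-take-conj s t) (dom t))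
                            (λ dom t → subst (_≤ sum (take t ν)) (sym (sum-take-conj s t)) (dom t))

-- Wide partitions

module WidePartition {l : List ℕ} (l-partition : IsPartition l) (l-wide : Wide l) where

  m : ℕ
  m = largest l

  l-sorted : Sorted l
  l-sorted = proj₂ l-partition

  l≤m : All (_≤ m) l
  l≤m = Sorted⇒All≤largest l-sorted

  dominates : ∀ {κ} → IsPartition κ → κ ⊆ₘ l → ∀ t → ∑[ x ← κ ] (x ⊓ t) ≤ sum (take t κ)
  dominates κ-partition κ⊆l = Equivalence.to (Dominates-conj⇔ (proj₂ κ-partition)) (l-wide _ (κ-partition , κ⊆l))

  length≤largest : length l ≤ m
  length≤largest = begin
    length l            ≡⟨ sym (*-identityʳ (length l)) ⟩
    length l * 1        ≡⟨ sym (sumMap-const 1 l) ⟩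
    ∑[ x ← l ] 1        ≡⟨ sumMap-cong-local (All.map (sym ∘ m≥n⇒m⊓n≡n) (proj₁ l-partition)) ⟩
    ∑[ x ← l ] (x ⊓ 1)  ≤⟨ dominates l-partition (⊆ₘ-refl l) 1 ⟩
    sum (take 1 l)      ≡⟨ sum-take-1 l ⟩
    m                   ∎
    where open ≤-Reasoning

  -- Wideness is applied to the parts below r + t; a part x ≥ r + t contributes t to both sides.
  sumMap-⊓≤shifted : ∀ r t → ∑[ x ← l ] (x ⊓ t) ≤ r * t + ∑[ x ← l ] ((x ∸ r) ⊓ t)
  sumMap-⊓≤shifted r t = begin
    ∑[ x ← l ] (x ⊓ t)
      ≡⟨ sym (sumMap-partition short? (_⊓ t) l) ⟩
    ∑[ x ← short ] (x ⊓ t) + ∑[ x ← long ] (x ⊓ t)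
      ≤⟨ +-monoˡ-≤ _ (dominates (IsPartition-filter short? l-partition) (filter-⊆ₘ short? l) t) ⟩
    sum (take t short) + ∑[ x ← long ] (x ⊓ t)
      ≤⟨ +-monoˡ-≤ _ (sum-take≤ r t short) ⟩
    (t * r + ∑[ x ← short ] (x ∸ r)) + ∑[ x ← long ] (x ⊓ t)
      ≡⟨ cong₂ (λ u v → (t * r + u) + v) (sumMap-cong-local short-eq) (sumMap-cong-local long-eq) ⟩
    (t * r + sumMap shifted short) + sumMap shifted long
      ≡⟨ +-assoc (t * r) _ _ ⟩
    t * r + (sumMap shifted short + sumMap shifted long)
      ≡⟨ cong₂ _+_ (*-comm t r) (sumMap-partition short? shifted l) ⟩
    r * t + sumMap shifted l
      ∎
    where
      open ≤-Reasoning
      short? = _<? r + t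
      short = filter short? l
      long = filter (∁? short?) l
      shifted = λ x → (x ∸ r) ⊓ t
      short-eq : All (λ x → x ∸ r ≡ shifted x) short
      short-eq = All.map (λ x<r+t → sym (m≤n⇒m⊓n≡m (m≤n+o⇒m∸n≤o _ r (<⇒≤ x<r+t)))) (All.all-filter short? l)
      long-eq : All (λ x → x ⊓ t ≡ shifted x) long
      long-eq = All.map (λ x≮r+t → let r+t≤x = ≮⇒≥ x≮r+t in
                          trans (m≥n⇒m⊓n≡n (≤-trans (m≤n+m t r) r+t≤x))
                                (sym (m≥n⇒m⊓n≡n (m+n≤o⇒m≤o∸n t (≤-trans (≤-reflexive (+-comm t r)) r+t≤x)))))
                        (All.all-filter (∁? short?) l)

  sum-drop-+≤ : ∀ s r → sum (drop (s + r) l) ≤ ∑[ x ← drop s l ] (x ∸ r)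
  sum-drop-+≤ s r = subst (_≤ ∑[ x ← drop s l ] (x ∸ r)) (cong sum (drop-drop s r l))
    (sum-drop≤sumMap-∸ r (drop s l) (dominates (IsPartition-drop s l-partition) (drop-⊆ₘ s l) r))

  module ConjugateTail {α : List ℕ} (α-sorted : Sorted α) (α⊆l' : α ⊆ₘ conj l) where

    a r : ℕ
    a = length α
    r = m ∸ a

    a≤m : a ≤ m
    a≤m = subst (a ≤_) (length-conj l) (length-mono-⊆ₘ α⊆l')

    countAbove≤part : ∀ i → countAbove (r + i) l ≤ part α i
    countAbove≤part i = subst (_≤ part α i)
      (trans (cong (λ k → part (conj l) (k ∸ a + i)) (length-conj l)) (part-conj l-sorted (r + i)))
      (part-⊆ₘ (Sorted-conj l) α-sorted α⊆l' i)

    shifted≤sum-take : ∀ k → ∑[ x ← l ] ((x ∸ r) ⊓ k) ≤ sum (take k α)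
    shifted≤sum-take k = begin
      ∑[ x ← l ] ((x ∸ r) ⊓ k)         ≡⟨ sym (sumUpTo-countAbove r k l) ⟩
      ∑[ j < k ] countAbove (r + j) l  ≤⟨ sumUpTo-mono countAbove≤part k ⟩
      ∑[ j < k ] part α j              ≡⟨ sumUpTo-part (λ y → y) refl α k ⟩
      ∑[ y ← take k α ] y              ≡⟨ sumMap-id (take k α) ⟩
      sum (take k α)                   ∎
      where open ≤-Reasoning

    sumMap-drop-∸≤ : ∀ s → ∑[ x ← drop s l ] (x ∸ r) ≤ ∑[ y ← α ] (y ∸ s)
    sumMap-drop-∸≤ s = begin
      ∑[ x ← drop s l ] (x ∸ r)
        ≡⟨ sumMap-cong-local (All.map (λ x≤m → sym (m≤n⇒m⊓n≡m (≤-trans (m∸n≤m _ r) x≤m))) (All.drop⁺ s l≤m)) ⟩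
      ∑[ x ← drop s l ] ((x ∸ r) ⊓ m)
        ≡⟨ sym (sumUpTo-countAbove r m (drop s l)) ⟩
      ∑[ j < m ] countAbove (r + j) (drop s l)
        ≡⟨ sumUpTo-cong (λ j → countAbove-drop (r + j) s l-sorted) m ⟩
      ∑[ j < m ] (countAbove (r + j) l ∸ s)
        ≤⟨ sumUpTo-mono (λ j → ∸-monoˡ-≤ s (countAbove≤part j)) m ⟩
      ∑[ j < m ] (part α j ∸ s)
        ≡⟨ sumUpTo-part (_∸ s) (0∸n≡0 s) α m ⟩
      ∑[ y ← take m α ] (y ∸ s)
        ≡⟨ cong (sumMap (_∸ s)) (take-all m α a≤m) ⟩
      ∑[ y ← α ] (y ∸ s)
        ∎
      where open ≤-Reasoning

    sumMap-∸≤sum : ∑[ x ← l ] (x ∸ r) ≤ sum α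
    sumMap-∸≤sum = ≤-trans (sumMap-drop-∸≤ 0) (≤-reflexive (sumMap-id α))

    -- ν is the general shape of a subpartition of bigμ l (see decompose below).
    module Blocks (b : ℕ) (K : List ℕ) (b≤m : b ≤ m) (K-partition : IsPartition K) (K⊆l : K ⊆ₘ l) where

      c : ℕ
      c = 2 * m

      ν : List ℕ
      ν = map (c +_) α ++ replicate b c ++ K

      c≡m+m : c ≡ m + m
      c≡m+m = cong (m +_) (+-identityʳ m)

      a+b≤c : a + b ≤ c
      a+b≤c = subst (a + b ≤_) (sym c≡m+m) (+-mono-≤ a≤m b≤m)

      r+a≡m : r + a ≡ m
      r+a≡m = m∸n+n≡m a≤m

      sumMap-⊓-ν : ∀ t → ∑[ x ← ν ] (x ⊓ t) ≡ ∑[ y ← α ] ((c + y) ⊓ t) + (b * (c ⊓ t) + ∑[ x ← K ] (x ⊓ t))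
      sumMap-⊓-ν t = trans (sumMap-++ f (map (c +_) α) (replicate b c ++ K))
        (cong₂ _+_ (sumMap-map f (c +_) α)
                   (trans (sumMap-++ f (replicate b c) K) (cong (_+ sumMap f K) (sumMap-replicate f b c))))
        where f = _⊓ t

      sumMap-⊓-ν-≤c : ∀ {t} → t ≤ c → ∑[ x ← ν ] (x ⊓ t) ≡ (a + b) * t + ∑[ x ← K ] (x ⊓ t)
      sumMap-⊓-ν-≤c {t} t≤c = begin
        ∑[ x ← ν ] (x ⊓ t)
          ≡⟨ sumMap-⊓-ν t ⟩
        ∑[ y ← α ] ((c + y) ⊓ t) + (b * (c ⊓ t) + ∑[ x ← K ] (x ⊓ t))
          ≡⟨ cong₂ (λ u v → u + (b * v + ∑[ x ← K ] (x ⊓ t))) α-part (m≥n⇒m⊓n≡n t≤c) ⟩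
        a * t + (b * t + ∑[ x ← K ] (x ⊓ t))
          ≡⟨ sym (+-assoc (a * t) _ _) ⟩
        (a * t + b * t) + ∑[ x ← K ] (x ⊓ t)
          ≡⟨ cong (_+ ∑[ x ← K ] (x ⊓ t)) (sym (*-distribʳ-+ t a b)) ⟩
        (a + b) * t + ∑[ x ← K ] (x ⊓ t)
          ∎
        where
          open ≡-Reasoning
          α-part : ∑[ y ← α ] ((c + y) ⊓ t) ≡ a * t
          α-part = trans (sumMap-cong (λ y → m≥n⇒m⊓n≡n (≤-trans t≤c (m≤m+n c y))) α) (sumMap-const t α)

      sum-take-ν-≤ : ∀ {t} → t ≤ a + b → sum (take t ν) ≡ c * t + sum (take t α)
      sum-take-ν-≤ = sum-take-blocks c α b K

      sum-take-ν-≥ : ∀ {t} → a + b ≤ t → sum (take t ν) ≡ ((a + b) * c + sum α) + sum (take (t ∸ (a + b)) K)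
      sum-take-ν-≥ {t} a+b≤t = begin
        sum (take t ν)
          ≡⟨ cong (sum ∘ take t) (sym (++-assoc (map (c +_) α) (replicate b c) K)) ⟩
        sum (take t (front ++ K))
          ≡⟨ sum-take-++ front K (subst (_≤ t) (sym length-front) a+b≤t) ⟩
        sum front + sum (take (t ∸ length front) K)
          ≡⟨ cong₂ (λ u v → u + sum (take (t ∸ v) K)) sum-front length-front ⟩
        ((a + b) * c + sum α) + sum (take (t ∸ (a + b)) K)
          ∎
        where
          open ≡-Reasoning
          front = map (c +_) α ++ replicate b c
          length-front : length front ≡ a + b
          length-front = trans (length-++ (map (c +_) α)) (cong₂ _+_ (length-map (c +_) α) (length-replicate b))
          sum-front : sum front ≡ (a + b) * c + sum α
          sum-front = begin
            sum front
              ≡⟨ sum-++ (map (c +_) α) (replicate b c) ⟩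
            ∑[ y ← α ] (c + y) + sum (replicate b c)
              ≡⟨ cong₂ _+_ (sumMap-+ (λ _ → c) (λ y → y) α)
                           (trans (sym (sumMap-id (replicate b c))) (sumMap-replicate (λ y → y) b c)) ⟩
            (∑[ y ← α ] c + ∑[ y ← α ] y) + b * c
              ≡⟨ cong₂ (λ u v → (u + v) + b * c) (sumMap-const c α) (sumMap-id α) ⟩
            (a * c + sum α) + b * c
              ≡⟨ +-right-comm (a * c) (sum α) (b * c) ⟩
            (a * c + b * c) + sum α
              ≡⟨ cong (_+ sum α) (sym (*-distribʳ-+ c a b)) ⟩
            (a + b) * c + sum α
              ∎

      dominates-≤a+b : ∀ t → t ≤ a + b → ∑[ x ← ν ] (x ⊓ t) ≤ sum (take t ν)
      dominates-≤a+b t t≤a+b = begin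
        ∑[ x ← ν ] (x ⊓ t)                                ≡⟨ sumMap-⊓-ν-≤c (≤-trans t≤a+b a+b≤c) ⟩
        (a + b) * t + ∑[ x ← K ] (x ⊓ t)                  ≤⟨ +-monoʳ-≤ ((a + b) * t) (sumMap-mono-⊆ₘ (_⊓ t) K⊆l) ⟩
        (a + b) * t + ∑[ x ← l ] (x ⊓ t)                  ≤⟨ +-monoʳ-≤ ((a + b) * t) (sumMap-⊓≤shifted r t) ⟩
        (a + b) * t + (r * t + ∑[ x ← l ] ((x ∸ r) ⊓ t))  ≤⟨ +-monoʳ-≤ ((a + b) * t) (+-monoʳ-≤ _ (shifted≤sum-take t)) ⟩
        (a + b) * t + (r * t + sum (take t α))            ≡⟨ sym (+-assoc ((a + b) * t) (r * t) _) ⟩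
        ((a + b) * t + r * t) + sum (take t α)            ≡⟨ cong (_+ sum (take t α)) (sym (*-distribʳ-+ t (a + b) r)) ⟩
        ((a + b) + r) * t + sum (take t α)                ≤⟨ +-monoˡ-≤ _ (*-monoˡ-≤ t a+b+r≤c) ⟩
        c * t + sum (take t α)                            ≡⟨ sym (sum-take-ν-≤ t≤a+b) ⟩
        sum (take t ν)                                    ∎
        where
          open ≤-Reasoning
          a+b+r≤c : (a + b) + r ≤ c
          a+b+r≤c = begin
            (a + b) + r  ≡⟨ +-right-comm a b r ⟩
            (a + r) + b  ≡⟨ cong (_+ b) (trans (+-comm a r) r+a≡m) ⟩
            m + b        ≤⟨ +-monoʳ-≤ m b≤m ⟩
            m + m        ≡⟨ sym c≡m+m ⟩
            c            ∎

      sumMap-⊓-∸≤ : ∀ t → a + b ≤ t → t ≤ c → ∑[ x ← l ] (x ⊓ t ∸ (t ∸ (a + b))) ≤ (a + b) * (c ∸ t) + sum α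
      sumMap-⊓-∸≤ t a+b≤t t≤c with t ≤? m
      ... | yes t≤m = begin
        ∑[ x ← l ] (x ⊓ t ∸ s)
          ≤⟨ sumMap-mono (λ x → ≤-trans (∸-monoˡ-≤ s (m⊓n≤n x t)) (≤-reflexive (m∸[m∸n]≡n a+b≤t))) l ⟩
        ∑[ x ← l ] (a + b)
          ≡⟨ sumMap-const (a + b) l ⟩
        length l * (a + b)
          ≤⟨ *-monoˡ-≤ (a + b) (≤-trans length≤largest m≤c∸t) ⟩
        (c ∸ t) * (a + b)
          ≡⟨ *-comm (c ∸ t) (a + b) ⟩
        (a + b) * (c ∸ t)
          ≤⟨ m≤m+n _ (sum α) ⟩
        (a + b) * (c ∸ t) + sum α
          ∎
        where
          open ≤-Reasoning
          s = t ∸ (a + b)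
          m≤c∸t : m ≤ c ∸ t
          m≤c∸t = ≤-trans (≤-reflexive (sym (trans (cong (_∸ m) c≡m+m) (m+n∸m≡n m m)))) (∸-monoʳ-≤ c t≤m)
      ... | no t≰m = begin
        ∑[ x ← l ] (x ⊓ t ∸ s)
          ≡⟨ sumMap-cong-local (All.map (λ x≤m → cong (_∸ s) (m≤n⇒m⊓n≡m (≤-trans x≤m m≤t))) l≤m) ⟩
        ∑[ x ← l ] (x ∸ s)
          ≤⟨ sumMap-mono (λ x → ∸-triangle x r s) l ⟩
        ∑[ x ← l ] ((x ∸ r) + (r ∸ s))
          ≡⟨ sumMap-+ (_∸ r) (λ _ → r ∸ s) l ⟩
        ∑[ x ← l ] (x ∸ r) + ∑[ x ← l ] (r ∸ s)
          ≡⟨ cong (∑[ x ← l ] (x ∸ r) +_) (sumMap-const (r ∸ s) l) ⟩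
        ∑[ x ← l ] (x ∸ r) + length l * (r ∸ s)
          ≤⟨ +-mono-≤ sumMap-∸≤sum (*-mono-≤ length≤largest r∸s≤b∸x) ⟩
        sum α + m * (b ∸ x)
          ≤⟨ +-monoʳ-≤ (sum α) (*-∸-exchange m b x b≤m) ⟩
        sum α + b * (m ∸ x)
          ≤⟨ +-monoʳ-≤ (sum α) (*-monoˡ-≤ (m ∸ x) (m≤n+m b a)) ⟩
        sum α + (a + b) * (m ∸ x)
          ≡⟨ cong (λ u → sum α + (a + b) * u) m∸x≡c∸t ⟩
        sum α + (a + b) * (c ∸ t)
          ≡⟨ +-comm (sum α) _ ⟩
        (a + b) * (c ∸ t) + sum α
          ∎
        where
          open ≤-Reasoning
          s = t ∸ (a + b)
          m≤t = <⇒≤ (≰⇒> t≰m)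
          x = t ∸ m
          t≡m+x : t ≡ m + x
          t≡m+x = sym (m+[n∸m]≡n m≤t)
          m∸x≡c∸t : m ∸ x ≡ c ∸ t
          m∸x≡c∸t = sym (trans (cong₂ _∸_ c≡m+m t≡m+x) ([m+n]∸[m+o]≡n∸o m m x))
          rearrange : ∀ s a d x → s + (a + (x + d)) ≡ (s + d) + (a + x)
          rearrange = solve-∀
          r∸s≤b∸x : r ∸ s ≤ b ∸ x
          r∸s≤b∸x = m≤n+o⇒m∸n≤o r s (+-cancelʳ-≤ (a + x) r (s + (b ∸ x)) (begin
            r + (a + x)              ≡⟨ sym (+-assoc r a x) ⟩
            (r + a) + x              ≡⟨ cong (_+ x) r+a≡m ⟩
            m + x                    ≡⟨ sym t≡m+x ⟩
            t                        ≡⟨ sym (m∸n+n≡m a+b≤t) ⟩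
            s + (a + b)              ≤⟨ +-monoʳ-≤ s (+-monoʳ-≤ a (m≤n+m∸n b x)) ⟩
            s + (a + (x + (b ∸ x)))  ≡⟨ rearrange s a (b ∸ x) x ⟩
            (s + (b ∸ x)) + (a + x)  ∎))

      dominates-≤c : ∀ t → a + b ≤ t → t ≤ c → ∑[ x ← ν ] (x ⊓ t) ≤ sum (take t ν)
      dominates-≤c t a+b≤t t≤c = begin
        ∑[ x ← ν ] (x ⊓ t)
          ≡⟨ sumMap-⊓-ν-≤c t≤c ⟩
        (a + b) * t + ∑[ x ← K ] (x ⊓ t)
          ≡⟨ cong ((a + b) * t +_) K-split ⟩
        (a + b) * t + (∑[ x ← K ] (x ⊓ s) + ∑[ x ← K ] (x ⊓ t ∸ s))
          ≤⟨ +-monoʳ-≤ ((a + b) * t) (+-mono-≤ (dominates K-partition K⊆l s) rest≤) ⟩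
        (a + b) * t + (sum (take s K) + ((a + b) * (c ∸ t) + sum α))
          ≡⟨ rearrange (a + b) t (c ∸ t) _ _ ⟩
        ((a + b) * (t + (c ∸ t)) + sum α) + sum (take s K)
          ≡⟨ cong (λ u → ((a + b) * u + sum α) + sum (take s K)) (m+[n∸m]≡n t≤c) ⟩
        ((a + b) * c + sum α) + sum (take s K)
          ≡⟨ sym (sum-take-ν-≥ a+b≤t) ⟩
        sum (take t ν)
          ∎
        where
          open ≤-Reasoning
          s = t ∸ (a + b)
          K-split : ∑[ x ← K ] (x ⊓ t) ≡ ∑[ x ← K ] (x ⊓ s) + ∑[ x ← K ] (x ⊓ t ∸ s)
          K-split = trans (sumMap-cong (⊓-split (m∸n≤m t (a + b))) K) (sumMap-+ (_⊓ s) (λ x → x ⊓ t ∸ s) K)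
          rest≤ : ∑[ x ← K ] (x ⊓ t ∸ s) ≤ (a + b) * (c ∸ t) + sum α
          rest≤ = ≤-trans (sumMap-mono-⊆ₘ (λ x → x ⊓ t ∸ s) K⊆l) (sumMap-⊓-∸≤ t a+b≤t t≤c)
          rearrange : ∀ p t u T A → p * t + (T + (p * u + A)) ≡ (p * (t + u) + A) + T
          rearrange = solve-∀

      sum-drop-K≤ : ∀ s → sum (drop (s + r) K) ≤ ∑[ y ← α ] (y ∸ s)
      sum-drop-K≤ s = begin
        sum (drop (s + r) K)       ≤⟨ sum-drop-mono-⊆ₘ (proj₂ K-partition) l-sorted K⊆l (s + r) ⟩
        sum (drop (s + r) l)       ≤⟨ sum-drop-+≤ s r ⟩
        ∑[ x ← drop s l ] (x ∸ r)  ≤⟨ sumMap-drop-∸≤ s ⟩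
        ∑[ y ← α ] (y ∸ s)         ∎
        where open ≤-Reasoning

      dominates->c : ∀ t → c < t → ∑[ x ← ν ] (x ⊓ t) ≤ sum (take t ν)
      dominates->c t c<t = begin
        ∑[ x ← ν ] (x ⊓ t)
          ≡⟨ sumMap-⊓-ν t ⟩
        ∑[ y ← α ] ((c + y) ⊓ t) + (b * (c ⊓ t) + ∑[ x ← K ] (x ⊓ t))
          ≡⟨ cong₂ _+_ α-part (cong₂ (λ u v → b * u + v) (m≤n⇒m⊓n≡m c≤t) K-part) ⟩
        (a * c + P) + (b * c + sum K)
          ≡⟨ cong (λ u → (a * c + P) + (b * c + u)) (sym (sum-take-drop s' K)) ⟩
        (a * c + P) + (b * c + (sum (take s' K) + sum (drop s' K)))
          ≤⟨ +-monoʳ-≤ (a * c + P) (+-monoʳ-≤ (b * c) (+-monoʳ-≤ (sum (take s' K)) drop-bound)) ⟩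
        (a * c + P) + (b * c + (sum (take s' K) + Q))
          ≡⟨ rearrange a b c P (sum (take s' K)) Q ⟩
        ((a + b) * c + (P + Q)) + sum (take s' K)
          ≡⟨ cong (λ u → ((a + b) * c + u) + sum (take s' K)) (sumMap-⊓-∸ s α) ⟩
        ((a + b) * c + sum α) + sum (take s' K)
          ≡⟨ sym (sum-take-ν-≥ (≤-trans a+b≤c c≤t)) ⟩
        sum (take t ν)
          ∎
        where
          open ≤-Reasoning
          c≤t = <⇒≤ c<t
          s = t ∸ c
          s' = t ∸ (a + b)
          P = ∑[ y ← α ] (y ⊓ s)
          Q = ∑[ y ← α ] (y ∸ s)
          m≤t : m ≤ t
          m≤t = ≤-trans (m≤m+n m m) (subst (_≤ t) c≡m+m c≤t)
          α-part : ∑[ y ← α ] ((c + y) ⊓ t) ≡ a * c + P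
          α-part = begin-equality
            ∑[ y ← α ] ((c + y) ⊓ t)
              ≡⟨ sumMap-cong (λ y → trans (cong ((c + y) ⊓_) (sym (m+[n∸m]≡n c≤t))) (sym (+-distribˡ-⊓ c y s))) α ⟩
            ∑[ y ← α ] (c + y ⊓ s)
              ≡⟨ sumMap-+ (λ _ → c) (_⊓ s) α ⟩
            ∑[ y ← α ] c + P
              ≡⟨ cong (_+ P) (sumMap-const c α) ⟩
            a * c + P
              ∎
          K-part : ∑[ x ← K ] (x ⊓ t) ≡ sum K
          K-part = trans (sumMap-cong-local (All.map (λ x≤m → m≤n⇒m⊓n≡m (≤-trans x≤m m≤t)) K≤m)) (sumMap-id K)
            where K≤m = All-resp-⊆ₘ K⊆l l≤m
          rearrange′ : ∀ s r a b → (s + r) + (a + b) ≡ s + ((r + a) + b)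
          rearrange′ = solve-∀
          s+r≤s' : s + r ≤ s'
          s+r≤s' = m+n≤o⇒m≤o∸n (s + r) (begin
            (s + r) + (a + b)  ≡⟨ rearrange′ s r a b ⟩
            s + ((r + a) + b)  ≡⟨ cong (λ u → s + (u + b)) r+a≡m ⟩
            s + (m + b)        ≤⟨ +-monoʳ-≤ s (+-monoʳ-≤ m b≤m) ⟩
            s + (m + m)        ≡⟨ cong (s +_) (sym c≡m+m) ⟩
            s + c              ≡⟨ +-comm s c ⟩
            c + s              ≡⟨ m+[n∸m]≡n c≤t ⟩
            t                  ∎)
          drop-bound : sum (drop s' K) ≤ Q
          drop-bound = ≤-trans (sum-drop-antitone K s+r≤s') (sum-drop-K≤ s)
          rearrange : ∀ a b c P T Q → (a * c + P) + (b * c + (T + Q)) ≡ ((a + b) * c + (P + Q)) + T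
          rearrange = solve-∀

      dominates-ν : ∀ t → ∑[ x ← ν ] (x ⊓ t) ≤ sum (take t ν)
      dominates-ν t with t ≤? a + b | t ≤? c
      ... | yes t≤a+b | _       = dominates-≤a+b t t≤a+b
      ... | no t≰a+b  | yes t≤c = dominates-≤c t (<⇒≤ (≰⇒> t≰a+b)) t≤c
      ... | no _      | no t≰c  = dominates->c t (≰⇒> t≰c)

-- Subpartitions of μ

All≡⇒replicate : ∀ {A : Set} {c : A} {xs} → All (_≡ c) xs → xs ≡ replicate (length xs) c
All≡⇒replicate []         = refl
All≡⇒replicate (x≡c ∷ ps) = cong₂ _∷_ x≡c (All≡⇒replicate ps)

module Pivot (c : ℕ) where

  above? : Decidable (c <_)
  above? = c <?_

  at? : Decidable (_≡ c)
  at? = _≟ c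

  below? : Decidable (_< c)
  below? = _<? c

  all-below : ∀ {x ν} → Sorted (x ∷ ν) → x < c → All (_< c) (x ∷ ν)
  all-below s x<c = All.map (λ y≤x → ≤-<-trans y≤x x<c) (Sorted-All≤ s ≤-refl)

  sorted-split : ∀ {ν} → Sorted ν → ν ≡ filter above? ν ++ filter at? ν ++ filter below? ν
  sorted-split {[]}    _ = refl
  sorted-split {x ∷ ν} s with <-cmp c x
  ... | tri< c<x x≢c _ = begin
    x ∷ ν
      ≡⟨ cong (x ∷_) (sorted-split (Linked.tail s)) ⟩
    x ∷ (filter above? ν ++ filter at? ν ++ filter below? ν)
      ≡⟨ cong₂ _++_ (sym (filter-accept above? c<x))
                    (sym (cong₂ _++_ (filter-reject at? (x≢c ∘ sym)) (filter-reject below? (<-asym c<x)))) ⟩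
    filter above? (x ∷ ν) ++ filter at? (x ∷ ν) ++ filter below? (x ∷ ν)
      ∎
    where open ≡-Reasoning
  ... | tri≈ _ refl _ = begin
    c ∷ ν
      ≡⟨ cong (c ∷_) (sorted-split (Linked.tail s)) ⟩
    c ∷ (filter above? ν ++ filter at? ν ++ filter below? ν)
      ≡⟨ cong (λ u → c ∷ (u ++ filter at? ν ++ filter below? ν)) nothing-above ⟩
    c ∷ (filter at? ν ++ filter below? ν)
      ≡⟨ cong₂ _++_ (sym (filter-accept at? refl)) (sym (filter-reject below? (<-irrefl refl))) ⟩
    filter at? (c ∷ ν) ++ filter below? (c ∷ ν)
      ≡⟨ cong (_++ filter at? (c ∷ ν) ++ filter below? (c ∷ ν))
              (sym (trans (filter-reject above? (<-irrefl refl)) nothing-above)) ⟩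
    filter above? (c ∷ ν) ++ filter at? (c ∷ ν) ++ filter below? (c ∷ ν)
      ∎
    where
      open ≡-Reasoning
      nothing-above : filter above? ν ≡ []
      nothing-above = filter-none above? (All.map ≤⇒≯ (Sorted⇒All≤head s))
  ... | tri> _ _ x<c = sym (begin
    filter above? (x ∷ ν) ++ filter at? (x ∷ ν) ++ filter below? (x ∷ ν)
      ≡⟨ cong₂ (λ u v → u ++ v ++ filter below? (x ∷ ν))
               (filter-none above? (All.map <⇒≯ (all-below s x<c)))
               (filter-none at? (All.map <⇒≢ (all-below s x<c))) ⟩
    filter below? (x ∷ ν)
      ≡⟨ filter-all below? (all-below s x<c) ⟩
    x ∷ ν
      ∎)
    where open ≡-Reasoning

  module _ {A B C : List ℕ} (A>c : All (c <_) A) (B≡c : All (_≡ c) B) (C<c : All (_< c) C) where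

    filter-above : filter above? (A ++ B ++ C) ≡ A
    filter-above = begin
      filter above? (A ++ B ++ C)
        ≡⟨ filter-++ above? A (B ++ C) ⟩
      filter above? A ++ filter above? (B ++ C)
        ≡⟨ cong (filter above? A ++_) (filter-++ above? B C) ⟩
      filter above? A ++ filter above? B ++ filter above? C
        ≡⟨ cong₂ (λ u v → u ++ v ++ filter above? C)
                 (filter-all above? A>c) (filter-none above? (All.map (λ { refl → <-irrefl refl }) B≡c)) ⟩
      A ++ filter above? C
        ≡⟨ cong (A ++_) (filter-none above? (All.map <⇒≯ C<c)) ⟩
      A ++ []
        ≡⟨ ++-identityʳ A ⟩
      A
        ∎
      where open ≡-Reasoning

    filter-at : filter at? (A ++ B ++ C) ≡ B
    filter-at = begin
      filter at? (A ++ B ++ C)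
        ≡⟨ filter-++ at? A (B ++ C) ⟩
      filter at? A ++ filter at? (B ++ C)
        ≡⟨ cong (filter at? A ++_) (filter-++ at? B C) ⟩
      filter at? A ++ filter at? B ++ filter at? C
        ≡⟨ cong₂ (λ u v → u ++ v ++ filter at? C)
                 (filter-none at? (All.map (λ c<x x≡c → <⇒≢ c<x (sym x≡c)) A>c)) (filter-all at? B≡c) ⟩
      B ++ filter at? C
        ≡⟨ cong (B ++_) (filter-none at? (All.map <⇒≢ C<c)) ⟩
      B ++ []
        ≡⟨ ++-identityʳ B ⟩
      B
        ∎
      where open ≡-Reasoning

    filter-below : filter below? (A ++ B ++ C) ≡ C
    filter-below = begin
      filter below? (A ++ B ++ C)
        ≡⟨ filter-++ below? A (B ++ C) ⟩
      filter below? A ++ filter below? (B ++ C)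
        ≡⟨ cong (filter below? A ++_) (filter-++ below? B C) ⟩
      filter below? A ++ filter below? B ++ filter below? C
        ≡⟨ cong₂ (λ u v → u ++ v ++ filter below? C)
                 (filter-none below? (All.map <⇒≯ A>c)) (filter-none below? (All.map (λ { refl → <-irrefl refl }) B≡c)) ⟩
      filter below? C
        ≡⟨ filter-all below? C<c ⟩
      C
        ∎
      where open ≡-Reasoning

record Decomposition (l ν : List ℕ) : Set where
  field
    α           : List ℕ
    b           : ℕ
    K           : List ℕ
    α-sorted    : Sorted α
    α⊆l'        : α ⊆ₘ conj l
    b≤m         : b ≤ largest l
    K-partition : IsPartition K
    K⊆l         : K ⊆ₘ l
    ν≡          : ν ≡ map (2 * largest l +_) α ++ replicate b (2 * largest l) ++ K

decompose : ∀ {l ν} → IsPartition l → IsPartition ν → ν ⊆ₘ bigμ l → Decomposition l ν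
decompose {l} {ν} (l-pos , l-sorted) ν-partition ν⊆μ = record
  { α           = α
  ; b           = length at
  ; K           = below
  ; α-sorted    = Linked.map⁺ (Linked.map (∸-monoˡ-≤ c) (proj₂ (IsPartition-filter above? ν-partition)))
  ; α⊆l'        = subst (α ⊆ₘ_) shift-back (map⁺-⊆ₘ (_∸ c) above⊆)
  ; b≤m         = subst (length at ≤_) (length-replicate m) (length-mono-⊆ₘ at⊆)
  ; K-partition = IsPartition-filter below? ν-partition
  ; K⊆l         = subst (below ⊆ₘ_) (filter-below μ>c μ≡c l<c) (filter⁺-⊆ₘ below? ν⊆μ)
  ; ν≡          = trans (sorted-split (proj₂ ν-partition))
                        (cong₂ (λ u v → u ++ v ++ below) above≡ (All≡⇒replicate (All.all-filter at? ν)))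
  }
  where
    m = largest l
    c = 2 * m
    open Pivot c
    above = filter above? ν
    at = filter at? ν
    below = filter below? ν
    α = map (_∸ c) above
    μ>c : All (c <_) (map (c +_) (conj l))
    μ>c = All.map⁺ (All.map (m<m+n c) (conj-positive l))
    μ≡c : All (_≡ c) (replicate m c)
    μ≡c = All.replicate⁺ m refl
    l<c : All (_< c) l
    l<c = All.zipWith (λ (1≤x , x≤m) → ≤-trans (+-mono-≤ 1≤x x≤m) (≤-trans (+-monoˡ-≤ m x≤m) (≤-reflexive m+m≡c)))
                      (l-pos , Sorted⇒All≤largest l-sorted)
      where m+m≡c = cong (m +_) (sym (+-identityʳ m))
    above⊆ : above ⊆ₘ map (c +_) (conj l)
    above⊆ = subst (above ⊆ₘ_) (filter-above μ>c μ≡c l<c) (filter⁺-⊆ₘ above? ν⊆μ)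
    at⊆ : at ⊆ₘ replicate m c
    at⊆ = subst (at ⊆ₘ_) (filter-at μ>c μ≡c l<c) (filter⁺-⊆ₘ at? ν⊆μ)
    shift-back : map (_∸ c) (map (c +_) (conj l)) ≡ conj l
    shift-back = trans (sym (map-∘ (conj l))) (trans (map-cong (m+n∸m≡n c) (conj l)) (map-id (conj l)))
    above≡ : above ≡ map (c +_) α
    above≡ = sym (trans (sym (map-∘ above)) (map-id-local (All.map (m+[n∸m]≡n ∘ <⇒≤) (All.all-filter above? ν))))

theorem6 : (l : List ℕ) → IsPartition l → Wide l → Wide (bigμ l)
theorem6 l l-partition l-wide ν (ν-partition , ν⊆μ) =
  Equivalence.from (Dominates-conj⇔ (proj₂ ν-partition))
    (subst (λ κ → ∀ t → ∑[ x ← κ ] (x ⊓ t) ≤ sum (take t κ)) (sym ν≡) dominates-ν)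
  where
    open Decomposition (decompose l-partition ν-partition ν⊆μ)
    open WidePartition l-partition l-wide
    open ConjugateTail α-sorted α⊆l'
    open Blocks b K b≤m K-partition K⊆l
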